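{- Let $(G_j)_{j\in\mathbb Z}$ and $(H_j)_{j\in\mathbb Z}$ be gibonacci sequences. For all integers $r$, $s$, $k$, $$H_{r+s}G_{k+1}-H_{r+s+1}G_k=(-1)^{r-1}(H_{s+1}+H_{s-1})G_{k-r}+(-1)^r\left(G_0H_{k+s-r-1}+G_1H_{k+s-r}\right).$$
   Context: A gibonacci sequence is a sequence $(G_j)_{j\in\mathbb Z}$ with arbitrary initial values $G_0,G_1$, not both zero, satisfying $G_j=G_{j-1}+G_{j-2}$ for all integers $j$; similarly for $(H_j)$ with seeds $H_0,H_1$. -}

module Defs where

open import Level using (Level)
open import Algebra.Bundles using (CommutativeRing)
open import Data.Integer using (ℤ; ∣_∣)
open import Data.Integer as ℤ using ()
open import Data.Nat using (ℕ; zero; suc)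
open import Data.Product using (_×_)
open import Relation.Nullary using (¬_)

module _ {c ℓ : Level} (R : CommutativeRing c ℓ) where
  open CommutativeRing R

  IsGibonacci : (ℤ → Carrier) → Set ℓ
  IsGibonacci G =
    ((j : ℤ) → G j ≈ G (j ℤ.- ℤ.+ 1) + G (j ℤ.- ℤ.+ 2))
    × ¬ (G (ℤ.+ 0) ≈ 0# × G (ℤ.+ 1) ≈ 0#)

  negOnePowℕ : ℕ → Carrier
  negOnePowℕ zero = 1#
  negOnePowℕ (suc n) = - negOnePowℕ n

  -- (-1)^r for an integer r; (-1)^r = (-1)^{|r|} since (-1)^{-1} = -1
  negOnePow : ℤ → Carrier
  negOnePow r = negOnePowℕ ∣ r ∣

  Prop18Identity : (G H : ℤ → Carrier) → ℤ → ℤ → ℤ → Set ℓ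
  Prop18Identity G H r s k =
    (H (r ℤ.+ s) * G (k ℤ.+ ℤ.+ 1)) - (H (r ℤ.+ s ℤ.+ ℤ.+ 1) * G k)
      ≈ (negOnePow (r ℤ.- ℤ.+ 1) * (H (s ℤ.+ ℤ.+ 1) + H (s ℤ.- ℤ.+ 1)) * G (k ℤ.- r))
        + (negOnePow r * ((G (ℤ.+ 0) * H (k ℤ.+ s ℤ.- r ℤ.- ℤ.+ 1)) + (G (ℤ.+ 1) * H (k ℤ.+ s ℤ.- r))))

-- Let W(a,b) = H_a G_{b+1} - H_{a+1} G_b (casoratian) and C(a,b) = G_b H_a + G_{b+1} H_{a+1}
-- (convolution). The recurrences give W(a+1,b+1) = -W(a,b) and C(a+1,b) = C(a,b+1), so the
-- left-hand side W(r+s,k) equals (-1)^r W(s,k-r), and G_0 H_{n-1} + G_1 H_n = C(n-1,0) equals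
-- C(s-1,k-r) for n = k+s-r. What remains is W(s,m) = C(s-1,m) - (H_{s+1} + H_{s-1}) G_m, a
-- one-step identity.
module Submission where

open import Level using (Level)
open import Algebra.Bundles using (CommutativeRing)
import Algebra.Properties.CommutativeSemigroup as CommutativeSemigroupProperties
import Algebra.Properties.Ring as RingProperties
import Algebra.Solver.Ring.NaturalCoefficients.Default as SemiringSolver
open import Data.Nat using (zero; suc)
import Data.Nat.Properties as ℕ
open import Data.Integer as ℤ using (ℤ; +_; -[1+_]; 0ℤ; 1ℤ)
import Data.Integer.Properties as ℤ
open import Data.Integer.Tactic.RingSolver using (solve-∀)
open import Data.Product using (_,_)
open import Relation.Binary.PropositionalEquality as ≡ using (_≡_)
import Relation.Binary.Reasoning.Setoid

open import Defs

[i+1+1]-1≡i+1 : ∀ i → i ℤ.+ 1ℤ ℤ.+ 1ℤ ℤ.- 1ℤ ≡ i ℤ.+ 1ℤ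
[i+1+1]-1≡i+1 = solve-∀

[i+1+1]-2≡i : ∀ i → i ℤ.+ 1ℤ ℤ.+ 1ℤ ℤ.- + 2 ≡ i
[i+1+1]-2≡i = solve-∀

i-1+1≡i : ∀ i → i ℤ.- 1ℤ ℤ.+ 1ℤ ≡ i
i-1+1≡i = solve-∀

[i+1]+j≡[i+j]+1 : ∀ i j → (i ℤ.+ 1ℤ) ℤ.+ j ≡ (i ℤ.+ j) ℤ.+ 1ℤ
[i+1]+j≡[i+j]+1 = solve-∀

i+[j+1]≡[i+j]+1 : ∀ i j → i ℤ.+ (j ℤ.+ 1ℤ) ≡ (i ℤ.+ j) ℤ.+ 1ℤ
i+[j+1]≡[i+j]+1 = solve-∀

i-j≡[i-[j+1]]+1 : ∀ i j → i ℤ.- j ≡ (i ℤ.- (j ℤ.+ 1ℤ)) ℤ.+ 1ℤ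
i-j≡[i-[j+1]]+1 = solve-∀

i≡j+[i-j] : ∀ i j → i ≡ j ℤ.+ (i ℤ.- j)
i≡j+[i-j] = solve-∀

[i-1]+[j-k]≡j+i-k-1 : ∀ i j k → (i ℤ.- 1ℤ) ℤ.+ (j ℤ.- k) ≡ j ℤ.+ i ℤ.- k ℤ.- 1ℤ
[i-1]+[j-k]≡j+i-k-1 = solve-∀

ℤ-induction : ∀ {p} (P : ℤ → Set p) → P 0ℤ →
              (∀ i → P i → P (i ℤ.+ 1ℤ)) → (∀ i → P (i ℤ.+ 1ℤ) → P i) →
              ∀ i → P i
ℤ-induction P P0 up down = λ where
    (+ n)    → nonNegative n
    -[1+ n ] → negative n
  where
  nonNegative : ∀ n → P (+ n)
  nonNegative zero    = P0
  nonNegative (suc n) = ≡.subst P (≡.cong +_ (ℕ.+-comm n 1)) (up (+ n) (nonNegative n))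

  negative : ∀ n → P -[1+ n ]
  negative zero    = down -[1+ 0 ] P0
  negative (suc n) = down -[1+ suc n ] (negative n)

module Gibonacci {c ℓ : Level} (R : CommutativeRing c ℓ) where
  open CommutativeRing R
  open RingProperties ring using (-‿involutive; -‿distribˡ-*; -‿distribʳ-*; ⁻¹-anti-homo‿-)
  open CommutativeSemigroupProperties +-commutativeSemigroup using (interchange)
  open SemiringSolver commutativeSemiring using (solve; _:=_; _:+_; _:*_)
  open Relation.Binary.Reasoning.Setoid setoid

  σ : ℤ → Carrier
  σ = negOnePow R

  x≈-y⇒y≈-x : ∀ {x y} → x ≈ - y → y ≈ - x
  x≈-y⇒y≈-x {x} {y} x≈-y = trans (sym (-‿involutive y)) (-‿cong (sym x≈-y))

  x+w≈z+y⇒x-y≈z-w : ∀ {x y z w} → x + w ≈ z + y → x - y ≈ z - w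
  x+w≈z+y⇒x-y≈z-w {x} {y} {z} {w} eq = begin
    x - y                   ≈⟨ +-identityʳ (x - y) ⟨
    (x - y) + 0#            ≈⟨ +-congˡ (-‿inverseʳ w) ⟨
    (x - y) + (w - w)       ≈⟨ interchange x (- y) w (- w) ⟩
    (x + w) + (- y - w)     ≈⟨ +-cong eq (+-comm (- y) (- w)) ⟩
    (z + y) + (- w - y)     ≈⟨ interchange z y (- w) (- y) ⟩
    (z - w) + (y - y)       ≈⟨ +-congˡ (-‿inverseʳ y) ⟩
    (z - w) + 0#            ≈⟨ +-identityʳ (z - w) ⟩
    z - w                   ∎

  x≈-y⇒x*u+y*v≈y*[v-u] : ∀ {x y} → x ≈ - y → ∀ u v → x * u + y * v ≈ y * (v - u)
  x≈-y⇒x*u+y*v≈y*[v-u] {x} {y} x≈-y u v = begin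
    x * u + y * v           ≈⟨ +-congʳ (*-congʳ x≈-y) ⟩
    - y * u + y * v         ≈⟨ +-congʳ (trans (sym (-‿distribˡ-* y u)) (-‿distribʳ-* y u)) ⟩
    y * - u + y * v         ≈⟨ distribˡ y (- u) v ⟨
    y * (- u + v)           ≈⟨ *-congˡ (+-comm (- u) v) ⟩
    y * (v - u)             ∎

  negOnePow[i+1]≈-negOnePow[i] : ∀ i → σ (i ℤ.+ 1ℤ) ≈ - σ i
  negOnePow[i+1]≈-negOnePow[i] (+ n)          = reflexive (≡.cong (negOnePowℕ R) (ℕ.+-comm n 1))
  negOnePow[i+1]≈-negOnePow[i] -[1+ zero ]    = sym (-‿involutive 1#)
  negOnePow[i+1]≈-negOnePow[i] -[1+ suc n ]   = sym (-‿involutive _)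

  negOnePow[i-1]≈-negOnePow[i] : ∀ i → σ (i ℤ.- 1ℤ) ≈ - σ i
  negOnePow[i-1]≈-negOnePow[i] i = x≈-y⇒y≈-x (trans (reflexive (≡.cong σ (≡.sym (i-1+1≡i i)))) (negOnePow[i+1]≈-negOnePow[i] (i ℤ.- 1ℤ)))

  module _ {φ : ℤ → Carrier} where

    shift-invariant⇒constant : (∀ i → φ (i ℤ.+ 1ℤ) ≈ φ i) → ∀ i → φ i ≈ φ 0ℤ
    shift-invariant⇒constant step = ℤ-induction (λ i → φ i ≈ φ 0ℤ) refl
      (λ i φi≈φ0 → trans (step i) φi≈φ0)
      (λ i φ[i+1]≈φ0 → trans (sym (step i)) φ[i+1]≈φ0)

    shift-antiinvariant⇒alternating : (∀ i → φ (i ℤ.+ 1ℤ) ≈ - φ i) → ∀ i → φ i ≈ σ i * φ 0ℤ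
    shift-antiinvariant⇒alternating step = ℤ-induction (λ i → φ i ≈ σ i * φ 0ℤ) (sym (*-identityˡ _))
      (λ i → negate (step i) (negOnePow[i+1]≈-negOnePow[i] i))
      (λ i → negate (x≈-y⇒y≈-x (step i)) (x≈-y⇒y≈-x (negOnePow[i+1]≈-negOnePow[i] i)))
      where
      negate : ∀ {x y a b} → x ≈ - y → b ≈ - a → y ≈ a * φ 0ℤ → x ≈ b * φ 0ℤ
      negate {a = a} x≈-y b≈-a y≈aφ0 =
        trans x≈-y (trans (-‿cong y≈aφ0) (trans (-‿distribˡ-* a _) (*-congʳ (sym b≈-a))))

  FibonacciRecurrence : (ℤ → Carrier) → Set ℓ
  FibonacciRecurrence f = ∀ i → f (i ℤ.+ 1ℤ ℤ.+ 1ℤ) ≈ f (i ℤ.+ 1ℤ) + f i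

  isGibonacci⇒fibonacciRecurrence : ∀ {f} → IsGibonacci R f → FibonacciRecurrence f
  isGibonacci⇒fibonacciRecurrence {f} (recurrence , _) i = trans (recurrence (i ℤ.+ 1ℤ ℤ.+ 1ℤ))
    (+-cong (reflexive (≡.cong f ([i+1+1]-1≡i+1 i))) (reflexive (≡.cong f ([i+1+1]-2≡i i))))

  module Pair {G H : ℤ → Carrier} (recG : FibonacciRecurrence G) (recH : FibonacciRecurrence H) where

    casoratian : ℤ → ℤ → Carrier
    casoratian a b = H a * G (b ℤ.+ 1ℤ) - H (a ℤ.+ 1ℤ) * G b

    convolution : ℤ → ℤ → Carrier
    convolution a b = G b * H a + G (b ℤ.+ 1ℤ) * H (a ℤ.+ 1ℤ)

    casoratian-step : ∀ a b → casoratian (a ℤ.+ 1ℤ) (b ℤ.+ 1ℤ) ≈ - casoratian a b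
    casoratian-step a b = begin
      H a₁ * G (b₁ ℤ.+ 1ℤ) - H (a₁ ℤ.+ 1ℤ) * G b₁  ≈⟨ +-cong (*-congˡ (recG b)) (-‿cong (*-congʳ (recH a))) ⟩
      H a₁ * (G b₁ + G b) - (H a₁ + H a) * G b₁    ≈⟨ x+w≈z+y⇒x-y≈z-w (solve 4 (λ h₁ h g₁ g →
                                                        h₁ :* (g₁ :+ g) :+ h :* g₁ := h₁ :* g :+ (h₁ :+ h) :* g₁)
                                                        refl (H a₁) (H a) (G b₁) (G b)) ⟩
      H a₁ * G b - H a * G b₁                      ≈⟨ ⁻¹-anti-homo‿- (H a * G b₁) (H a₁ * G b) ⟨
      - casoratian a b                              ∎
      where
      a₁ b₁ : ℤ
      a₁ = a ℤ.+ 1ℤ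
      b₁ = b ℤ.+ 1ℤ

    casoratian-shift : ∀ i a b → casoratian (i ℤ.+ a) (i ℤ.+ b) ≈ σ i * casoratian a b
    casoratian-shift i a b = trans
      (shift-antiinvariant⇒alternating {φ = λ j → casoratian (j ℤ.+ a) (j ℤ.+ b)} step i)
      (*-congˡ (reflexive (≡.cong₂ casoratian (ℤ.+-identityˡ a) (ℤ.+-identityˡ b))))
      where
      step : ∀ j → casoratian ((j ℤ.+ 1ℤ) ℤ.+ a) ((j ℤ.+ 1ℤ) ℤ.+ b) ≈ - casoratian (j ℤ.+ a) (j ℤ.+ b)
      step j = trans (reflexive (≡.cong₂ casoratian ([i+1]+j≡[i+j]+1 j a) ([i+1]+j≡[i+j]+1 j b)))
                     (casoratian-step (j ℤ.+ a) (j ℤ.+ b))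

    convolution-step : ∀ a b → convolution (a ℤ.+ 1ℤ) b ≈ convolution a (b ℤ.+ 1ℤ)
    convolution-step a b = begin
      G b * H a₁ + G b₁ * H (a₁ ℤ.+ 1ℤ)  ≈⟨ +-congˡ (*-congˡ (recH a)) ⟩
      G b * H a₁ + G b₁ * (H a₁ + H a)   ≈⟨ solve 4 (λ h₁ h g₁ g →
                                              g :* h₁ :+ g₁ :* (h₁ :+ h) := g₁ :* h :+ (g₁ :+ g) :* h₁)
                                              refl (H a₁) (H a) (G b₁) (G b) ⟩
      G b₁ * H a + (G b₁ + G b) * H a₁   ≈⟨ +-congˡ (*-congʳ (recG b)) ⟨
      G b₁ * H a + G (b₁ ℤ.+ 1ℤ) * H a₁  ∎
      where
      a₁ b₁ : ℤ
      a₁ = a ℤ.+ 1ℤ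
      b₁ = b ℤ.+ 1ℤ

    convolution-shift : ∀ i a b → convolution (a ℤ.+ i) (b ℤ.- i) ≈ convolution a b
    convolution-shift i a b = trans
      (shift-invariant⇒constant {φ = λ j → convolution (a ℤ.+ j) (b ℤ.- j)} step i)
      (reflexive (≡.cong₂ convolution (ℤ.+-identityʳ a) (ℤ.+-identityʳ b)))
      where
      step : ∀ j → convolution (a ℤ.+ (j ℤ.+ 1ℤ)) (b ℤ.- (j ℤ.+ 1ℤ)) ≈ convolution (a ℤ.+ j) (b ℤ.- j)
      step j = begin
        convolution (a ℤ.+ (j ℤ.+ 1ℤ)) (b ℤ.- (j ℤ.+ 1ℤ))   ≡⟨ ≡.cong (λ a′ → convolution a′ _) (i+[j+1]≡[i+j]+1 a j) ⟩
        convolution (a ℤ.+ j ℤ.+ 1ℤ) (b ℤ.- (j ℤ.+ 1ℤ))     ≈⟨ convolution-step (a ℤ.+ j) _ ⟩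
        convolution (a ℤ.+ j) (b ℤ.- (j ℤ.+ 1ℤ) ℤ.+ 1ℤ)     ≡⟨ ≡.cong (convolution _) (i-j≡[i-[j+1]]+1 b j) ⟨
        convolution (a ℤ.+ j) (b ℤ.- j)                       ∎

    casoratian≈convolution : ∀ a b →
      casoratian a b ≈ convolution (a ℤ.- 1ℤ) b - (H (a ℤ.+ 1ℤ) + H (a ℤ.- 1ℤ)) * G b
    casoratian≈convolution a b = x+w≈z+y⇒x-y≈z-w (begin
      H a * G b₁ + (H (a ℤ.+ 1ℤ) + H a₀) * G b
        ≈⟨ solve 5 (λ h h₁ h₀ g₁ g →
             h :* g₁ :+ (h₁ :+ h₀) :* g := g :* h₀ :+ g₁ :* h :+ h₁ :* g)
             refl (H a) (H (a ℤ.+ 1ℤ)) (H a₀) (G b₁) (G b) ⟩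
      G b * H a₀ + G b₁ * H a + H (a ℤ.+ 1ℤ) * G b
        ≡⟨ ≡.cong (λ j → G b * H a₀ + G b₁ * H j + H (a ℤ.+ 1ℤ) * G b) (i-1+1≡i a) ⟨
      convolution a₀ b + H (a ℤ.+ 1ℤ) * G b ∎)
      where
      a₀ b₁ : ℤ
      a₀ = a ℤ.- 1ℤ
      b₁ = b ℤ.+ 1ℤ

proposition18 : {c ℓ : Level} (R : CommutativeRing c ℓ) → (G H : ℤ → CommutativeRing.Carrier R) → IsGibonacci R G → IsGibonacci R H → (r s k : ℤ) → Prop18Identity R G H r s k
proposition18 R G H gibG gibH r s k = begin
  casoratian (r ℤ.+ s) k                                ≡⟨ ≡.cong (casoratian (r ℤ.+ s)) (i≡j+[i-j] k r) ⟩
  casoratian (r ℤ.+ s) (r ℤ.+ m)                        ≈⟨ casoratian-shift r s m ⟩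
  σ r * casoratian s m                                   ≈⟨ *-congˡ (casoratian≈convolution s m) ⟩
  σ r * (convolution (s ℤ.- 1ℤ) m - L * G m)            ≈⟨ x≈-y⇒x*u+y*v≈y*[v-u] (negOnePow[i-1]≈-negOnePow[i] r) (L * G m) _ ⟨
  σ (r ℤ.- 1ℤ) * (L * G m) + σ r * convolution (s ℤ.- 1ℤ) m
                                                          ≈⟨ +-cong (sym (*-assoc _ L (G m))) (*-congˡ convolution≈G₀H[n-1]+G₁H[n]) ⟩
  σ (r ℤ.- 1ℤ) * L * G m + σ r * (G 0ℤ * H (n ℤ.- 1ℤ) + G 1ℤ * H n) ∎
  where
  open CommutativeRing R
  open Relation.Binary.Reasoning.Setoid setoid
  open Gibonacci R
  open Pair (isGibonacci⇒fibonacciRecurrence gibG) (isGibonacci⇒fibonacciRecurrence gibH)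
  m n : ℤ
  m = k ℤ.- r
  n = k ℤ.+ s ℤ.- r
  L : Carrier
  L = H (s ℤ.+ 1ℤ) + H (s ℤ.- 1ℤ)
  convolution≈G₀H[n-1]+G₁H[n] : convolution (s ℤ.- 1ℤ) m ≈ G 0ℤ * H (n ℤ.- 1ℤ) + G 1ℤ * H n
  convolution≈G₀H[n-1]+G₁H[n] = begin
    convolution (s ℤ.- 1ℤ) m                          ≈⟨ convolution-shift m (s ℤ.- 1ℤ) m ⟨
    convolution (s ℤ.- 1ℤ ℤ.+ m) (m ℤ.- m)            ≡⟨ ≡.cong₂ convolution ([i-1]+[j-k]≡j+i-k-1 s k r) (ℤ.+-inverseʳ m) ⟩
    convolution (n ℤ.- 1ℤ) 0ℤ                          ≡⟨ ≡.cong (λ j → G 0ℤ * H (n ℤ.- 1ℤ) + G 1ℤ * H j) (i-1+1≡i n) ⟩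
    G 0ℤ * H (n ℤ.- 1ℤ) + G 1ℤ * H n                   ∎
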